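{- Let $K\le P$ be positive integers, $\theta=(K,P)$, and let $K_1(\theta),K_2(\theta),\dots$ be i.i.d. random sets, each uniformly distributed over the $K$-element subsets of $\{1,\dots,P\}$. For $r\ge1$ let $U_r(\theta)=\left|\bigcup_{i=1}^rK_i(\theta)\right|$. Then for every $r=1,2,\dots$ and every integer $x$ with $K\le x\le\min(rK,P)$, $$\mathbb{P}\big[U_r(\theta)\le x\big]\le\binom{P}{x}\left(\frac{\binom{x}{K}}{\binom{P}{K}}\right)^r .$$ -}

module Defs where

open import Data.Nat as ℕ using (ℕ; zero; suc; _≤_; _≟_; _≤?_)
open import Data.Nat.Combinatorics using (_C_)
open import Data.Integer using (+_)
open import Data.Rational as ℚ using (ℚ; 0ℚ; 1ℚ; _/_; _*_)
open import Data.Bool using (true; false)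
open import Data.List as List using (List; []; _∷_; map; concatMap; filter; length)
open import Data.Vec as Vec using (Vec; []; _∷_; toList)
open import Data.Fin.Subset using (Subset; ⋃; ∣_∣)

-- all subsets of {0,…,n-1} (as characteristic vectors), each exactly once
allSubsets : (n : ℕ) → List (Subset n)
allSubsets zero = [] ∷ []
allSubsets (suc n) = concatMap (λ s → (false ∷ s) ∷ (true ∷ s) ∷ []) (allSubsets n)

kSubsets : (K P : ℕ) → List (Subset P)
kSubsets K P = filter (λ s → ∣ s ∣ ≟ K) (allSubsets P)

tuples : {A : Set} → (r : ℕ) → List A → List (Vec A r)
tuples zero xs = [] ∷ []
tuples (suc r) xs = concatMap (λ a → map (a ∷_) (tuples r xs)) xs

-- sample space of (K_1(θ),…,K_r(θ)), uniform (i.i.d. uniform ⇒ uniform on tuples)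
sampleSpace : (K P r : ℕ) → List (Vec (Subset P) r)
sampleSpace K P r = tuples r (kSubsets K P)

U : {P r : ℕ} → Vec (Subset P) r → ℕ
U v = ∣ ⋃ (toList v) ∣

-- m / n as a rational (convention: 0 when n = 0; never used in that case here)
_÷ℕ_ : ℕ → ℕ → ℚ
m ÷ℕ zero = 0ℚ
m ÷ℕ suc n = (+ m) / suc n

_^ℚ_ : ℚ → ℕ → ℚ
q ^ℚ zero = 1ℚ
q ^ℚ suc r = q * (q ^ℚ r)

probUleq : (K P r x : ℕ) → ℚ
probUleq K P r x =
  length (filter (λ v → U v ≤? x) (sampleSpace K P r)) ÷ℕ length (sampleSpace K P r)

module Submission where

-- The sample space is the list of all r-tuples of K-subsets of {1,…,P}, so
-- P[U_r ≤ x] is a ratio of two counts.  The denominator is (P C K)^r.  For the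
-- numerator: if |K_1 ∪ … ∪ K_r| ≤ x ≤ P then the union is contained in some
-- x-subset S, so the indicator of {U_r ≤ x} is bounded by the number of
-- x-subsets S containing every K_i.  Exchanging the two sums, each of the
-- P C x subsets S is counted once for every tuple of K-subsets of S, i.e.
-- (x C K)^r times.  Hence #{U_r ≤ x} ≤ (P C x)·(x C K)^r, and dividing by the
-- denominator gives the theorem.

open import Defs
open import Data.Nat using (ℕ; zero; suc; _≤_; _+_; _*_; _^_; _≟_; _≤?_; _⊓_; z≤n; s≤s)
open import Data.Nat.Properties
open import Data.Nat.Combinatorics using (_C_; nCk+nC[k+1]≡[n+1]C[k+1])
open import Algebra.Properties.CommutativeSemigroup +-commutativeSemigroup using (interchange)
open import Data.Bool using (Bool; true; false; _∧_; if_then_else_)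
open import Data.Bool.ListAction using (all)
open import Data.Bool.Properties using (∧-zeroʳ)
open import Data.List using (List; []; _∷_; map; concatMap; filter; length; _++_)
open import Data.List.Properties using (length-map)
open import Data.List.Relation.Unary.Any as Any using (here; there)
open import Data.List.Membership.Propositional using (_∈_)
open import Data.List.Membership.Propositional.Properties using (∈-concatMap⁺; ∈-filter⁺; ∈-filter⁻)
open import Data.Vec using (Vec; []; _∷_; toList)
open import Data.Fin.Subset using (Subset; ⋃; ∣_∣; _∪_; ⊤; ⊥)
open import Data.Fin.Subset.Properties using (∣⊤∣≡n)
open import Data.Product using (_×_; _,_; ∃; proj₂)
open import Relation.Nullary using (Dec; yes; no; does)
open import Relation.Unary using (Decidable)
open import Relation.Binary.PropositionalEquality
import Data.Integer as ℤ
import Data.Integer.Properties as ℤP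
open import Data.Rational as ℚ using (ℚ; toℚᵘ)
import Data.Rational.Properties as ℚP
open import Data.Rational.Unnormalised as ℚᵘ using (mkℚᵘ; *≡*; *≤*)
import Data.Rational.Unnormalised.Properties as ℚᵘP

∑ : {A : Set} → List A → (A → ℕ) → ℕ
∑ [] f = 0
∑ (a ∷ as) f = f a + ∑ as f

𝟙 : Bool → ℕ
𝟙 b = if b then 1 else 0

𝟙-∧ : ∀ b c → 𝟙 (b ∧ c) ≡ 𝟙 b * 𝟙 c
𝟙-∧ true c = sym (+-identityʳ (𝟙 c))
𝟙-∧ false c = refl

module _ {A : Set} where

  ∑-cong : {f g : A → ℕ} (xs : List A) → (∀ a → f a ≡ g a) → ∑ xs f ≡ ∑ xs g
  ∑-cong [] e = refl
  ∑-cong (a ∷ as) e = cong₂ _+_ (e a) (∑-cong as e)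

  ∑-cong-∈ : {f g : A → ℕ} (xs : List A) → (∀ {a} → a ∈ xs → f a ≡ g a) → ∑ xs f ≡ ∑ xs g
  ∑-cong-∈ [] e = refl
  ∑-cong-∈ (a ∷ as) e = cong₂ _+_ (e (here refl)) (∑-cong-∈ as (λ a′∈as → e (there a′∈as)))

  ∑-mono : {f g : A → ℕ} (xs : List A) → (∀ a → f a ≤ g a) → ∑ xs f ≤ ∑ xs g
  ∑-mono [] e = z≤n
  ∑-mono (a ∷ as) e = +-mono-≤ (e a) (∑-mono as e)

  ∑-member : (f : A → ℕ) {a : A} {xs : List A} → a ∈ xs → f a ≤ ∑ xs f
  ∑-member f (here refl) = m≤m+n _ _
  ∑-member f {xs = b ∷ bs} (there a∈bs) = ≤-trans (∑-member f a∈bs) (m≤n+m _ (f b))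

  ∑-const : (xs : List A) (c : ℕ) → ∑ xs (λ _ → c) ≡ length xs * c
  ∑-const [] c = refl
  ∑-const (a ∷ as) c = cong (c +_) (∑-const as c)

  ∑-+ : (f g : A → ℕ) (xs : List A) → ∑ xs (λ a → f a + g a) ≡ ∑ xs f + ∑ xs g
  ∑-+ f g [] = refl
  ∑-+ f g (a ∷ as) = trans (cong (f a + g a +_) (∑-+ f g as)) (interchange (f a) (g a) (∑ as f) (∑ as g))

  ∑-*ˡ : (c : ℕ) (f : A → ℕ) (xs : List A) → ∑ xs (λ a → c * f a) ≡ c * ∑ xs f
  ∑-*ˡ c f [] = sym (*-zeroʳ c)
  ∑-*ˡ c f (a ∷ as) = trans (cong (c * f a +_) (∑-*ˡ c f as)) (sym (*-distribˡ-+ c (f a) _))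

  ∑-++ : (f : A → ℕ) (xs ys : List A) → ∑ (xs ++ ys) f ≡ ∑ xs f + ∑ ys f
  ∑-++ f [] ys = refl
  ∑-++ f (a ∷ as) ys = trans (cong (f a +_) (∑-++ f as ys)) (sym (+-assoc (f a) _ _))

  ∑-filter : {P : A → Set} (P? : Decidable P) (f : A → ℕ) (xs : List A) →
    ∑ (filter P? xs) f ≡ ∑ xs (λ a → if does (P? a) then f a else 0)
  ∑-filter P? f [] = refl
  ∑-filter P? f (a ∷ as) with does (P? a)
  ... | true = cong (f a +_) (∑-filter P? f as)
  ... | false = ∑-filter P? f as

  length-as-∑ : (xs : List A) → length xs ≡ ∑ xs (λ _ → 1)
  length-as-∑ [] = refl
  length-as-∑ (a ∷ as) = cong suc (length-as-∑ as)

  length-filter : {P : A → Set} (P? : Decidable P) (xs : List A) →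
    length (filter P? xs) ≡ ∑ xs (λ a → 𝟙 (does (P? a)))
  length-filter P? xs = trans (length-as-∑ (filter P? xs)) (∑-filter P? (λ _ → 1) xs)

module _ {A B : Set} where

  ∑-map : (f : B → ℕ) (g : A → B) (xs : List A) → ∑ (map g xs) f ≡ ∑ xs (λ a → f (g a))
  ∑-map f g [] = refl
  ∑-map f g (a ∷ as) = cong (f (g a) +_) (∑-map f g as)

  ∑-concatMap : (f : B → ℕ) (g : A → List B) (xs : List A) →
    ∑ (concatMap g xs) f ≡ ∑ xs (λ a → ∑ (g a) f)
  ∑-concatMap f g [] = refl
  ∑-concatMap f g (a ∷ as) = trans (∑-++ f (g a) (concatMap g as)) (cong (∑ (g a) f +_) (∑-concatMap f g as))

  ∑-swap : (h : A → B → ℕ) (xs : List A) (ys : List B) →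
    ∑ xs (λ a → ∑ ys (h a)) ≡ ∑ ys (λ b → ∑ xs (λ a → h a b))
  ∑-swap h [] ys = sym (trans (∑-const ys 0) (*-zeroʳ (length ys)))
  ∑-swap h (a ∷ as) ys =
    trans (cong (∑ ys (h a) +_) (∑-swap h as ys)) (sym (∑-+ (h a) (λ b → ∑ as (λ a′ → h a′ b)) ys))

count-tuples : {A : Set} (q : A → Bool) (xs : List A) (r : ℕ) →
  ∑ (tuples r xs) (λ v → 𝟙 (all q (toList v))) ≡ ∑ xs (λ a → 𝟙 (q a)) ^ r
count-tuples q xs zero = refl
count-tuples q xs (suc r) = begin
  ∑ (concatMap (λ a → map (a ∷_) (tuples r xs)) xs) (λ v → 𝟙 (all q (toList v)))
    ≡⟨ ∑-concatMap _ _ xs ⟩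
  ∑ xs (λ a → ∑ (map (a ∷_) (tuples r xs)) (λ v → 𝟙 (all q (toList v))))
    ≡⟨ ∑-cong xs (λ a → trans (∑-map _ _ (tuples r xs)) (first-entry a)) ⟩
  ∑ xs (λ a → 𝟙 (q a) * #good r)
    ≡⟨ trans (∑-cong xs (λ a → *-comm (𝟙 (q a)) _)) (∑-*ˡ (#good r) _ xs) ⟩
  #good r * #q
    ≡⟨ trans (cong (_* #q) (count-tuples q xs r)) (*-comm _ #q) ⟩
  #q ^ suc r ∎
  where
  open ≡-Reasoning
  #q = ∑ xs (λ a → 𝟙 (q a))
  #good : ℕ → ℕ
  #good m = ∑ (tuples m xs) (λ v → 𝟙 (all q (toList v)))
  first-entry : ∀ a → ∑ (tuples r xs) (λ v → 𝟙 (q a ∧ all q (toList v))) ≡ 𝟙 (q a) * #good r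
  first-entry a = trans (∑-cong (tuples r xs) (λ v → 𝟙-∧ (q a) _)) (∑-*ˡ (𝟙 (q a)) _ (tuples r xs))

length-tuples : {A : Set} (r : ℕ) (xs : List A) → length (tuples r xs) ≡ length xs ^ r
length-tuples zero xs = refl
length-tuples (suc r) xs = begin
  length (concatMap (λ a → map (a ∷_) (tuples r xs)) xs)  ≡⟨ length-as-∑ (concatMap (λ a → map (a ∷_) (tuples r xs)) xs) ⟩
  ∑ (concatMap (λ a → map (a ∷_) (tuples r xs)) xs) (λ _ → 1)  ≡⟨ ∑-concatMap _ _ xs ⟩
  ∑ xs (λ a → ∑ (map (a ∷_) (tuples r xs)) (λ _ → 1))
    ≡⟨ ∑-cong xs (λ a → trans (sym (length-as-∑ (map (a ∷_) (tuples r xs)))) (length-map (a ∷_) (tuples r xs))) ⟩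
  ∑ xs (λ _ → length (tuples r xs))  ≡⟨ ∑-const xs _ ⟩
  length xs * length (tuples r xs)  ≡⟨ cong (length xs *_) (length-tuples r xs) ⟩
  length xs ^ suc r ∎
  where open ≡-Reasoning

_⊆ᵇ_ : {n : ℕ} → Subset n → Subset n → Bool
[] ⊆ᵇ [] = true
(false ∷ p) ⊆ᵇ (_ ∷ q) = p ⊆ᵇ q
(true ∷ p) ⊆ᵇ (false ∷ q) = false
(true ∷ p) ⊆ᵇ (true ∷ q) = p ⊆ᵇ q

⊆ᵇ-⊤ : {n : ℕ} (p : Subset n) → p ⊆ᵇ ⊤ ≡ true
⊆ᵇ-⊤ [] = refl
⊆ᵇ-⊤ (false ∷ p) = ⊆ᵇ-⊤ p
⊆ᵇ-⊤ (true ∷ p) = ⊆ᵇ-⊤ p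

⊥-⊆ᵇ : {n : ℕ} (S : Subset n) → ⊥ ⊆ᵇ S ≡ true
⊥-⊆ᵇ [] = refl
⊥-⊆ᵇ (s ∷ S) = ⊥-⊆ᵇ S

∪-⊆ᵇ : {n : ℕ} (p q S : Subset n) → (p ∪ q) ⊆ᵇ S ≡ (p ⊆ᵇ S) ∧ (q ⊆ᵇ S)
∪-⊆ᵇ [] [] [] = refl
∪-⊆ᵇ (false ∷ p) (false ∷ q) (s ∷ S) = ∪-⊆ᵇ p q S
∪-⊆ᵇ (false ∷ p) (true ∷ q) (false ∷ S) with p ⊆ᵇ S
... | true = refl
... | false = refl
∪-⊆ᵇ (false ∷ p) (true ∷ q) (true ∷ S) = ∪-⊆ᵇ p q S
∪-⊆ᵇ (true ∷ p) (b ∷ q) (false ∷ S) = refl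
∪-⊆ᵇ (true ∷ p) (false ∷ q) (true ∷ S) = ∪-⊆ᵇ p q S
∪-⊆ᵇ (true ∷ p) (true ∷ q) (true ∷ S) = ∪-⊆ᵇ p q S

⋃-⊆ᵇ : {n : ℕ} (ps : List (Subset n)) (S : Subset n) → ⋃ ps ⊆ᵇ S ≡ all (_⊆ᵇ S) ps
⋃-⊆ᵇ [] S = ⊥-⊆ᵇ S
⋃-⊆ᵇ (p ∷ ps) S = trans (∪-⊆ᵇ p (⋃ ps) S) (cong ((p ⊆ᵇ S) ∧_) (⋃-⊆ᵇ ps S))

superset-of-size : (n : ℕ) (s : Subset n) (x : ℕ) → ∣ s ∣ ≤ x → x ≤ n →
  ∃ λ S → ∣ S ∣ ≡ x × s ⊆ᵇ S ≡ true
superset-of-size zero [] .zero z≤n z≤n = [] , refl , refl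
superset-of-size (suc n) (true ∷ s) (suc x) (s≤s h) (s≤s x≤n) with superset-of-size n s x h x≤n
... | S , ∣S∣≡x , s⊆S = true ∷ S , cong suc ∣S∣≡x , s⊆S
superset-of-size (suc n) (false ∷ s) x h x≤1+n with x ≤? n
... | yes x≤n with superset-of-size n s x h x≤n
...   | S , ∣S∣≡x , s⊆S = false ∷ S , ∣S∣≡x , s⊆S
superset-of-size (suc n) (false ∷ s) x h x≤1+n | no x≰n =
  ⊤ , trans (∣⊤∣≡n (suc n)) (≤-antisym (≰⇒> x≰n) x≤1+n) , ⊆ᵇ-⊤ s

∈-allSubsets : {n : ℕ} (s : Subset n) → s ∈ allSubsets n
∈-allSubsets [] = here refl
∈-allSubsets (b ∷ s) = ∈-concatMap⁺ _ (Any.map (λ { refl → with-head b }) (∈-allSubsets s))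
  where
  with-head : ∀ b → (b ∷ s) ∈ ((false ∷ s) ∷ (true ∷ s) ∷ [])
  with-head false = here refl
  with-head true = there (here refl)

∑-allSubsets-suc : {n : ℕ} (f : Subset (suc n) → ℕ) →
  ∑ (allSubsets (suc n)) f ≡ ∑ (allSubsets n) (λ t → f (false ∷ t) + f (true ∷ t))
∑-allSubsets-suc {n} f = trans (∑-concatMap f _ (allSubsets n))
  (∑-cong (allSubsets n) (λ t → cong (f (false ∷ t) +_) (+-identityʳ (f (true ∷ t)))))

isKSubsetOf : {n : ℕ} → ℕ → Subset n → Subset n → Bool
isKSubsetOf K S t = does (∣ t ∣ ≟ K) ∧ (t ⊆ᵇ S)

-- Pascal's rule: the K-subsets of {1,…,n} contained in S number ∣S∣ C K.
subsets-inside : (n K : ℕ) (S : Subset n) → ∑ (allSubsets n) (λ t → 𝟙 (isKSubsetOf K S t)) ≡ ∣ S ∣ C K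
subsets-inside zero zero [] = refl
subsets-inside zero (suc K) [] = refl
subsets-inside (suc n) K (false ∷ S) = begin
  ∑ (allSubsets (suc n)) (λ t → 𝟙 (isKSubsetOf K (false ∷ S) t))
    ≡⟨ ∑-allSubsets-suc (λ t → 𝟙 (isKSubsetOf K (false ∷ S) t)) ⟩
  ∑ (allSubsets n) (λ t → 𝟙 (isKSubsetOf K S t) + 𝟙 (does (suc ∣ t ∣ ≟ K) ∧ false))
    ≡⟨ ∑-cong (allSubsets n) (λ t → trans (cong (λ b → 𝟙 (isKSubsetOf K S t) + 𝟙 b)
                                                  (∧-zeroʳ (does (suc ∣ t ∣ ≟ K))))
                                            (+-identityʳ _)) ⟩
  ∑ (allSubsets n) (λ t → 𝟙 (isKSubsetOf K S t))
    ≡⟨ subsets-inside n K S ⟩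
  ∣ S ∣ C K ∎
  where open ≡-Reasoning
subsets-inside (suc n) zero (true ∷ S) = begin
  ∑ (allSubsets (suc n)) (λ t → 𝟙 (isKSubsetOf 0 (true ∷ S) t))
    ≡⟨ ∑-allSubsets-suc (λ t → 𝟙 (isKSubsetOf 0 (true ∷ S) t)) ⟩
  ∑ (allSubsets n) (λ t → 𝟙 (isKSubsetOf 0 S t) + 0)
    ≡⟨ ∑-cong (allSubsets n) (λ t → +-identityʳ _) ⟩
  ∑ (allSubsets n) (λ t → 𝟙 (isKSubsetOf 0 S t))
    ≡⟨ subsets-inside n zero S ⟩
  1 ∎
  where open ≡-Reasoning
subsets-inside (suc n) (suc K) (true ∷ S) = begin
  ∑ (allSubsets (suc n)) (λ t → 𝟙 (isKSubsetOf (suc K) (true ∷ S) t))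
    ≡⟨ ∑-allSubsets-suc (λ t → 𝟙 (isKSubsetOf (suc K) (true ∷ S) t)) ⟩
  ∑ (allSubsets n) (λ t → 𝟙 (isKSubsetOf (suc K) S t) + 𝟙 (isKSubsetOf K S t))
    ≡⟨ ∑-+ _ _ (allSubsets n) ⟩
  ∑ (allSubsets n) (λ t → 𝟙 (isKSubsetOf (suc K) S t)) + ∑ (allSubsets n) (λ t → 𝟙 (isKSubsetOf K S t))
    ≡⟨ cong₂ _+_ (subsets-inside n (suc K) S) (subsets-inside n K S) ⟩
  ∣ S ∣ C suc K + ∣ S ∣ C K
    ≡⟨ +-comm (∣ S ∣ C suc K) _ ⟩
  ∣ S ∣ C K + ∣ S ∣ C suc K
    ≡⟨ nCk+nC[k+1]≡[n+1]C[k+1] ∣ S ∣ K ⟩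
  suc ∣ S ∣ C suc K ∎
  where open ≡-Reasoning

module _ (K n : ℕ) where

  kSubsets-inside : (S : Subset n) → ∑ (kSubsets K n) (λ t → 𝟙 (t ⊆ᵇ S)) ≡ ∣ S ∣ C K
  kSubsets-inside S = trans (∑-filter (λ t → ∣ t ∣ ≟ K) _ (allSubsets n))
    (trans (∑-cong (allSubsets n) (λ t → if-as-∧ (does (∣ t ∣ ≟ K)) (t ⊆ᵇ S))) (subsets-inside n K S))
    where
    if-as-∧ : ∀ b c → (if b then 𝟙 c else 0) ≡ 𝟙 (b ∧ c)
    if-as-∧ true c = refl
    if-as-∧ false c = refl

  length-kSubsets : length (kSubsets K n) ≡ n C K
  length-kSubsets = begin
    length (kSubsets K n)                  ≡⟨ length-as-∑ (kSubsets K n) ⟩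
    ∑ (kSubsets K n) (λ _ → 1)             ≡⟨ ∑-cong (kSubsets K n) (λ t → cong 𝟙 (sym (⊆ᵇ-⊤ t))) ⟩
    ∑ (kSubsets K n) (λ t → 𝟙 (t ⊆ᵇ ⊤))    ≡⟨ kSubsets-inside ⊤ ⟩
    ∣ ⊤ {n} ∣ C K                          ≡⟨ cong (_C K) (∣⊤∣≡n n) ⟩
    n C K ∎
    where open ≡-Reasoning

module UnionBound (K P r x : ℕ) (x≤P : x ≤ P) where

  #covers : Vec (Subset P) r → ℕ
  #covers v = ∑ (kSubsets x P) (λ S → 𝟙 (⋃ (toList v) ⊆ᵇ S))

  -- The event U_r ≤ x is covered by at least one x-subset.
  indicator≤#covers : ∀ v → 𝟙 (does (U v ≤? x)) ≤ #covers v
  indicator≤#covers v = bound (U v ≤? x)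
    where
    bound : (d : Dec (U v ≤ x)) → 𝟙 (does d) ≤ #covers v
    bound (no _) = z≤n
    bound (yes Uv≤x) with superset-of-size P (⋃ (toList v)) x Uv≤x x≤P
    ... | S , ∣S∣≡x , ⋃v⊆S = subst (_≤ #covers v) (cong 𝟙 ⋃v⊆S)
          (∑-member (λ S → 𝟙 (⋃ (toList v) ⊆ᵇ S))
                    (∈-filter⁺ (λ t → ∣ t ∣ ≟ x) {xs = allSubsets P} (∈-allSubsets S) ∣S∣≡x))

  covered-by : ∀ {S} → S ∈ kSubsets x P →
    ∑ (sampleSpace K P r) (λ v → 𝟙 (⋃ (toList v) ⊆ᵇ S)) ≡ (x C K) ^ r
  covered-by {S} S∈ = begin
    ∑ (sampleSpace K P r) (λ v → 𝟙 (⋃ (toList v) ⊆ᵇ S))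
      ≡⟨ ∑-cong (sampleSpace K P r) (λ v → cong 𝟙 (⋃-⊆ᵇ (toList v) S)) ⟩
    ∑ (sampleSpace K P r) (λ v → 𝟙 (all (_⊆ᵇ S) (toList v)))  ≡⟨ count-tuples (_⊆ᵇ S) (kSubsets K P) r ⟩
    ∑ (kSubsets K P) (λ t → 𝟙 (t ⊆ᵇ S)) ^ r                        ≡⟨ cong (_^ r) (kSubsets-inside K P S) ⟩
    (∣ S ∣ C K) ^ r
      ≡⟨ cong (λ m → (m C K) ^ r) (proj₂ (∈-filter⁻ (λ t → ∣ t ∣ ≟ x) {xs = allSubsets P} S∈)) ⟩
    (x C K) ^ r ∎
    where open ≡-Reasoning

  favourable-count : length (filter (λ v → U v ≤? x) (sampleSpace K P r)) ≤ (P C x) * (x C K) ^ r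
  favourable-count = begin
    length (filter (λ v → U v ≤? x) Ω)                      ≡⟨ length-filter _ Ω ⟩
    ∑ Ω (λ v → 𝟙 (does (U v ≤? x)))                         ≤⟨ ∑-mono Ω indicator≤#covers ⟩
    ∑ Ω #covers                                             ≡⟨ ∑-swap (λ v S → 𝟙 (⋃ (toList v) ⊆ᵇ S)) Ω (kSubsets x P) ⟩
    ∑ (kSubsets x P) (λ S → ∑ Ω (λ v → 𝟙 (⋃ (toList v) ⊆ᵇ S)))  ≡⟨ ∑-cong-∈ (kSubsets x P) covered-by ⟩
    ∑ (kSubsets x P) (λ _ → (x C K) ^ r)                    ≡⟨ ∑-const (kSubsets x P) _ ⟩
    length (kSubsets x P) * (x C K) ^ r                     ≡⟨ cong (_* (x C K) ^ r) (length-kSubsets x P) ⟩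
    (P C x) * (x C K) ^ r ∎
    where
    open ≤-Reasoning
    Ω = sampleSpace K P r

sampleSpace-size : (K P r : ℕ) → length (sampleSpace K P r) ≡ (P C K) ^ r
sampleSpace-size K P r = trans (length-tuples r (kSubsets K P)) (cong (_^ r) (length-kSubsets K P))

÷ℕ-toℚᵘ : ∀ a d → toℚᵘ (a ÷ℕ suc d) ℚᵘ.≃ mkℚᵘ (ℤ.+ a) d
÷ℕ-toℚᵘ a d = ℚP.toℚᵘ-fromℚᵘ (mkℚᵘ (ℤ.+ a) d)

÷ℕ-monoˡ-≤ : ∀ {a c} d → a ≤ c → (a ÷ℕ d) ℚ.≤ (c ÷ℕ d)
÷ℕ-monoˡ-≤ zero a≤c = ℚP.≤-refl
÷ℕ-monoˡ-≤ {a} {c} (suc d) a≤c = ℚP.toℚᵘ-cancel-≤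
  (ℚᵘP.≤-respˡ-≃ (ℚᵘP.≃-sym (÷ℕ-toℚᵘ a d)) (ℚᵘP.≤-respʳ-≃ (ℚᵘP.≃-sym (÷ℕ-toℚᵘ c d))
    (*≤* (subst₂ ℤ._≤_ (ℤP.pos-* a (suc d)) (ℤP.pos-* c (suc d)) (ℤ.+≤+ (*-monoˡ-≤ (suc d) a≤c))))))

-- Fractions multiply numerator by numerator and denominator by denominator
-- (also under the convention m ÷ℕ 0 = 0).
÷ℕ-* : ∀ a b c d → (a ÷ℕ b) ℚ.* (c ÷ℕ d) ≡ (a * c) ÷ℕ (b * d)
÷ℕ-* a zero c d = ℚP.*-zeroˡ (c ÷ℕ d)
÷ℕ-* a (suc b) c zero = trans (ℚP.*-zeroʳ (a ÷ℕ suc b)) (cong ((a * c) ÷ℕ_) (sym (*-zeroʳ (suc b))))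
÷ℕ-* a (suc b) c (suc d) = ℚP.toℚᵘ-injective (ℚᵘP.≃-trans (ℚP.toℚᵘ-homo-* (a ÷ℕ suc b) (c ÷ℕ suc d))
  (ℚᵘP.≃-trans (ℚᵘP.*-cong (÷ℕ-toℚᵘ a b) (÷ℕ-toℚᵘ c d))
  (ℚᵘP.≃-trans (*≡* (cong (ℤ._* (ℤ.+ (suc b * suc d))) (sym (ℤP.pos-* a c)))) (ℚᵘP.≃-sym (÷ℕ-toℚᵘ (a * c) _)))))

÷ℕ-^ : ∀ a b r → (a ÷ℕ b) ^ℚ r ≡ (a ^ r) ÷ℕ (b ^ r)
÷ℕ-^ a b zero = refl
÷ℕ-^ a b (suc r) = trans (cong ((a ÷ℕ b) ℚ.*_) (÷ℕ-^ a b r)) (÷ℕ-* a b (a ^ r) (b ^ r))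

-- The theorem: probUleq = #{U_r ≤ x} / (P C K)^r ≤ (P C x)·(x C K)^r / (P C K)^r.
lemma8 : (K P : ℕ) → 1 ≤ K → K ≤ P → (r : ℕ) → 1 ≤ r → (x : ℕ) → K ≤ x → x ≤ (r * K) ⊓ P →
    probUleq K P r x ℚ.≤ ((P C x) ÷ℕ 1) ℚ.* (((x C K) ÷ℕ (P C K)) ^ℚ r)
lemma8 K P _ _ r _ x _ x≤ = begin
  N ÷ℕ length (sampleSpace K P r)                   ≡⟨ cong (N ÷ℕ_) (sampleSpace-size K P r) ⟩
  N ÷ℕ D                                            ≤⟨ ÷ℕ-monoˡ-≤ D (UnionBound.favourable-count K P r x x≤P) ⟩
  ((P C x) * (x C K) ^ r) ÷ℕ D                      ≡⟨ cong (((P C x) * (x C K) ^ r) ÷ℕ_) (sym (*-identityˡ D)) ⟩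
  ((P C x) * (x C K) ^ r) ÷ℕ (1 * D)                ≡⟨ sym (÷ℕ-* (P C x) 1 ((x C K) ^ r) D) ⟩
  ((P C x) ÷ℕ 1) ℚ.* (((x C K) ^ r) ÷ℕ D)           ≡⟨ cong (((P C x) ÷ℕ 1) ℚ.*_) (sym (÷ℕ-^ (x C K) (P C K) r)) ⟩
  ((P C x) ÷ℕ 1) ℚ.* (((x C K) ÷ℕ (P C K)) ^ℚ r) ∎
  where
  open ℚP.≤-Reasoning
  x≤P = ≤-trans x≤ (m⊓n≤n (r * K) P)
  N = length (filter (λ v → U v ≤? x) (sampleSpace K P r))
  D = (P C K) ^ r
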